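{- For every parameter $\rho\in\{\mathrm{sn},\underline{\mathrm{lcs}},\overline{\mathrm{scs}},\overline{\mathrm{lcs}}\}$ and every value $N>0$, there are graphs $H\subsetneqq G$ (with $H$ a proper subgraph of $G$) with $\chi(H)=\chi(G)$ satisfying $\rho(H)>N\rho(G)$.
   Context: For a graph $G=(V,E)$ and an integer $k\ge\chi(G)$, a proper $k$-colouring is a map $c\colon V\to\{1,\dots,k\}$ with adjacent vertices receiving different colours. A determining set for $(G,c)$ is a set $S\subseteq V$ such that no proper $k$-colouring $c'\neq c$ satisfies $c'(s)=c(s)$ for all $s\in S$; a critical set is an inclusion-minimal determining set. $\mathrm{scs}(G,c)$ and $\mathrm{lcs}(G,c)$ are the minimum and maximum size of a critical set for $(G,c)$. With $k=\chi(G)$: $\mathrm{sn}(G)=\min_c\mathrm{scs}(G,c)$, $\underline{\mathrm{lcs}}(G)=\min_c\mathrm{lcs}(G,c)$, $\overline{\mathrm{scs}}(G)=\max_c\mathrm{scs}(G,c)$, $\overline{\mathrm{lcs}}(G)=\max_c\mathrm{lcs}(G,c)$, where $c$ ranges over proper $\chi(G)$-colourings of $G$. -}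

module Defs where

open import Data.Nat using (ℕ; _≤_; _<_; _*_; _>_)
open import Data.Fin using (Fin)
open import Data.Fin.Subset using (Subset; _∈_; _⊆_; ∣_∣)
open import Data.Bool using (Bool; true; false)
open import Data.Product using (Σ; ∃; _×_; _,_)
open import Data.Sum using (_⊎_)
open import Relation.Binary.PropositionalEquality using (_≡_; _≢_)
open import Relation.Nullary using (¬_)

record Graph : Set where
  field
    n      : ℕ
    adj    : Fin n → Fin n → Bool
    sym    : ∀ u v → adj u v ≡ adj v u
    irrefl : ∀ v → adj v v ≡ false

open Graph public

Edge : (G : Graph) → Fin (n G) → Fin (n G) → Set
Edge G u v = adj G u v ≡ true

Colouring : Graph → ℕ → Set
Colouring G k = Fin (n G) → Fin k

Proper : (G : Graph) (k : ℕ) → Colouring G k → Set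
Proper G k c = ∀ u v → Edge G u v → c u ≢ c v

IsChromatic : Graph → ℕ → Set
IsChromatic G k =
  (Σ (Colouring G k) (Proper G k)) ×
  (∀ j → j < k → ¬ Σ (Colouring G j) (Proper G j))

Determining : (G : Graph) (k : ℕ) → Colouring G k → Subset (n G) → Set
Determining G k c S =
  ∀ (c' : Colouring G k) → Proper G k c' →
    (∀ s → s ∈ S → c' s ≡ c s) → ∀ v → c' v ≡ c v

Critical : (G : Graph) (k : ℕ) → Colouring G k → Subset (n G) → Set
Critical G k c S =
  Determining G k c S ×
  (∀ S' → S' ⊆ S → Determining G k c S' → S ⊆ S')

CritSize : (G : Graph) (k : ℕ) → Colouring G k → ℕ → Set
CritSize G k c m = Σ (Subset (n G)) λ S → Critical G k c S × ∣ S ∣ ≡ m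

IsMinOf : (ℕ → Set) → ℕ → Set
IsMinOf P m = P m × (∀ j → P j → m ≤ j)

IsMaxOf : (ℕ → Set) → ℕ → Set
IsMaxOf P m = P m × (∀ j → P j → j ≤ m)

IsScs : (G : Graph) (k : ℕ) → Colouring G k → ℕ → Set
IsScs G k c = IsMinOf (CritSize G k c)

IsLcs : (G : Graph) (k : ℕ) → Colouring G k → ℕ → Set
IsLcs G k c = IsMaxOf (CritSize G k c)

data Param : Set where
  sn lcs-min scs-max lcs-max : Param

Over : (G : Graph) (k : ℕ) →
       ((c : Colouring G k) → ℕ → Set) → ℕ → Set
Over G k Q m = Σ (Colouring G k) λ c → Proper G k c × Q c m

ParamValue : Param → Graph → ℕ → Set
ParamValue ρ G m = Σ ℕ λ k → IsChromatic G k × go ρ k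
  where
  go : Param → ℕ → Set
  go sn      k = IsMinOf (Over G k (IsScs G k)) m
  go lcs-min k = IsMinOf (Over G k (IsLcs G k)) m
  go scs-max k = IsMaxOf (Over G k (IsScs G k)) m
  go lcs-max k = IsMaxOf (Over G k (IsLcs G k)) m

-- H is a proper subgraph of G, via an injective vertex map f (identifying H's
-- vertices with a subset of G's vertices); every edge of H is an edge of G,
-- and H ≠ G: either H misses a vertex, or misses an edge of G between its vertices.
ProperSubgraph : (H G : Graph) → Set
ProperSubgraph H G =
  Σ (Fin (n H) → Fin (n G)) λ f →
    (∀ u v → f u ≡ f v → u ≡ v) ×
    (∀ u v → Edge H u v → Edge G (f u) (f v)) ×
    (n H < n G ⊎ Σ (Fin (n H)) λ u → Σ (Fin (n H)) λ v →
        Edge G (f u) (f v) × ¬ Edge H u v)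

-- A determining set of a proper 2-colouring must meet every nonempty union of
-- components, since swapping the two colours on such a union gives another proper
-- colouring; conversely, inside a connected component one coloured vertex fixes
-- all the others. In the star K(1,m+1) every vertex alone is therefore a critical
-- set, whereas in its spanning subgraph formed by one edge and m isolated vertices
-- a critical set is exactly one endpoint of the edge together with all isolated
-- vertices. All critical sets of all 2-colourings thus have size 1 in the star and
-- m + 1 in the subgraph, so each of the four parameters jumps from 1 to m + 1.
module Submission where

open import Defs hiding (sym)
open import Data.Nat using (ℕ; _*_; _>_; _<_; zero; suc; s≤s; _∸_)
open import Data.Nat.Properties using (≤-reflexive; *-identityʳ)
open import Data.Product using (Σ; ∃; _×_; _,_; proj₁; proj₂)
open import Data.Sum using (_⊎_; inj₁; inj₂)
open import Data.Bool using (Bool; true; false)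
open import Data.Empty using (⊥-elim)
open import Data.Fin using (Fin; zero; suc; opposite)
open import Data.Fin.Properties using (opposite-involutive; ¬Fin0)
open import Data.Fin.Subset using (Subset; _∈_; _∉_; _⊆_; ∣_∣; ⁅_⁆; ⊥; ∁; _∩_; Nonempty; inside)
open import Data.Fin.Subset.Properties
  using (⊆-antisym; ∈⊤; x∈⁅x⁆; x∈⁅y⁆⇒x≡y; x≢y⇒x∉⁅y⁆; ∣⁅x⁆∣≡1; x∈∁p⇒x∉p; x∉p⇒x∈∁p;
         ∣∁p∣≡n∸∣p∣; ∉⊥; x∈p∩q⁺; x∈p∩q⁻; nonempty?; _∈?_)
open import Relation.Binary.PropositionalEquality
  using (_≡_; _≢_; refl; sym; trans; cong; subst; module ≡-Reasoning)
open import Data.Vec using (_∷_; here; there)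
open import Relation.Nullary using (¬_; yes; no)

opposite-injective : ∀ {k} {i j : Fin k} → opposite i ≡ opposite j → i ≡ j
opposite-injective {i = i} {j} eq = begin
  i                     ≡⟨ sym (opposite-involutive i) ⟩
  opposite (opposite i) ≡⟨ cong opposite eq ⟩
  opposite (opposite j) ≡⟨ opposite-involutive j ⟩
  j                     ∎
  where open ≡-Reasoning

opposite≢ : (i : Fin 2) → opposite i ≢ i
opposite≢ zero ()
opposite≢ (suc zero) ()

x≢z∧y≢z⇒x≡y : {x y z : Fin 2} → x ≢ z → y ≢ z → x ≡ y
x≢z∧y≢z⇒x≡y {zero}     {zero}     _   _   = refl
x≢z∧y≢z⇒x≡y {suc zero} {suc zero} _   _   = refl
x≢z∧y≢z⇒x≡y {zero}     {suc zero} {zero}     x≢z _   = ⊥-elim (x≢z refl)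
x≢z∧y≢z⇒x≡y {zero}     {suc zero} {suc zero} _   y≢z = ⊥-elim (y≢z refl)
x≢z∧y≢z⇒x≡y {suc zero} {zero}     {zero}     _   y≢z = ⊥-elim (y≢z refl)
x≢z∧y≢z⇒x≡y {suc zero} {zero}     {suc zero} x≢z _   = ⊥-elim (x≢z refl)

edge-sym : (X : Graph) {u v : Fin (n X)} → Edge X u v → Edge X v u
edge-sym X {u} {v} e = trans (sym (Graph.sym X u v)) e

proper-∘ : (H G : Graph) {k : ℕ} (f : Fin (n H) → Fin (n G)) →
  (∀ u v → Edge H u v → Edge G (f u) (f v)) →
  (c : Colouring G k) → Proper G k c → Proper H k (λ v → c (f v))
proper-∘ H G f hom c pc u v e = pc (f u) (f v) (hom u v e)

isChromatic-two : (X : Graph) {u v : Fin (n X)} → Edge X u v →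
  Σ (Colouring X 2) (Proper X 2) → IsChromatic X 2
isChromatic-two X {u} {v} e twoColouring = twoColouring , fewer
  where
  fewer : ∀ j → j < 2 → ¬ Σ (Colouring X j) (Proper X j)
  fewer zero          _                 (c , _)  = ¬Fin0 (c u)
  fewer (suc zero)    _                 (c , pc) with c u | c v | pc u v e
  ... | zero | zero | c≢ = c≢ refl
  fewer (suc (suc j)) (s≤s (s≤s ()))    _

agree-across-edge : (X : Graph) {c c' : Colouring X 2} → Proper X 2 c → Proper X 2 c' →
  ∀ {u v} → Edge X u v → c' u ≡ c u → c' v ≡ c v
agree-across-edge X pc pc' {u} {v} e eq =
  x≢z∧y≢z⇒x≡y (λ c'v≡cu → pc' v u (edge-sym X e) (trans c'v≡cu (sym eq)))
              (pc v u (edge-sym X e))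

Closed : (X : Graph) → Subset (n X) → Set
Closed X C = ∀ u v → Edge X u v → u ∈ C → v ∈ C

flipOn : ∀ {m} → Subset m → (Fin m → Fin 2) → Fin m → Fin 2
flipOn C c v with v ∈? C
... | yes _ = opposite (c v)
... | no  _ = c v

flipOn-∈ : ∀ {m} {C : Subset m} (c : Fin m → Fin 2) {v} → v ∈ C → flipOn C c v ≡ opposite (c v)
flipOn-∈ {C = C} c {v} v∈C with v ∈? C
... | yes _   = refl
... | no  v∉C = ⊥-elim (v∉C v∈C)

flipOn-∉ : ∀ {m} {C : Subset m} (c : Fin m → Fin 2) {v} → v ∉ C → flipOn C c v ≡ c v
flipOn-∉ {C = C} c {v} v∉C with v ∈? C
... | yes v∈C = ⊥-elim (v∉C v∈C)
... | no  _   = refl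

flipOn-proper : (X : Graph) {C : Subset (n X)} → Closed X C →
  (c : Colouring X 2) → Proper X 2 c → Proper X 2 (flipOn C c)
flipOn-proper X {C} closed c pc u v e eq with u ∈? C | v ∈? C
... | yes _   | yes _   = pc u v e (opposite-injective eq)
... | yes u∈C | no  v∉C = v∉C (closed u v e u∈C)
... | no  u∉C | yes v∈C = u∉C (closed v u (edge-sym X e) v∈C)
... | no  _   | no  _   = pc u v e eq

determining-meets-closed : (X : Graph) {C : Subset (n X)} → Closed X C → Nonempty C →
  (c : Colouring X 2) → Proper X 2 c →
  ∀ {S} → Determining X 2 c S → ∃ λ v → v ∈ S × v ∈ C
determining-meets-closed X {C} closed (v , v∈C) c pc {S} det with nonempty? (S ∩ C)
... | yes (w , w∈S∩C) = w , x∈p∩q⁻ S C w∈S∩C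
... | no  S∩C-empty   = ⊥-elim (opposite≢ (c v) (begin
  opposite (c v) ≡⟨ sym (flipOn-∈ c v∈C) ⟩
  flipOn C c v   ≡⟨ det (flipOn C c) (flipOn-proper X closed c pc) agreeOnS v ⟩
  c v            ∎))
  where
  open ≡-Reasoning
  agreeOnS : ∀ s → s ∈ S → flipOn C c s ≡ c s
  agreeOnS s s∈S = flipOn-∉ c (λ s∈C → S∩C-empty (s , x∈p∩q⁺ (s∈S , s∈C)))

Isolated : (X : Graph) → Fin (n X) → Set
Isolated X v = ∀ w → ¬ Edge X v w

isolated-closed : (X : Graph) {v : Fin (n X)} → Isolated X v → Closed X ⁅ v ⁆
isolated-closed X {v} isolated u w e u∈⁅v⁆ =
  ⊥-elim (isolated w (subst (λ x → Edge X x w) (x∈⁅y⁆⇒x≡y v u∈⁅v⁆) e))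

isolated-∈-determining : (X : Graph) {v : Fin (n X)} → Isolated X v →
  (c : Colouring X 2) → Proper X 2 c → ∀ {S} → Determining X 2 c S → v ∈ S
isolated-∈-determining X {v} isolated c pc det
  with determining-meets-closed X (isolated-closed X isolated) (v , x∈⁅x⁆ v) c pc det
... | w , w∈S , w∈⁅v⁆ = subst (_∈ _) (x∈⁅y⁆⇒x≡y v w∈⁅v⁆) w∈S

determining-nonempty : (X : Graph) → Fin (n X) → (c : Colouring X 2) → Proper X 2 c →
  ∀ {S} → Determining X 2 c S → Nonempty S
determining-nonempty X v c pc det
  with determining-meets-closed X (λ _ _ _ _ → ∈⊤) (v , ∈⊤) c pc det
... | w , w∈S , _ = w , w∈S

⁅x⁆⊆ : ∀ {m} {x : Fin m} {S : Subset m} → x ∈ S → ⁅ x ⁆ ⊆ S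
⁅x⁆⊆ {x = x} x∈S y∈⁅x⁆ = subst (_∈ _) (sym (x∈⁅y⁆⇒x≡y x y∈⁅x⁆)) x∈S

x≢y⇒x∈∁⁅y⁆ : ∀ {m} {x y : Fin m} → x ≢ y → x ∈ ∁ ⁅ y ⁆
x≢y⇒x∈∁⁅y⁆ x≢y = x∉p⇒x∈∁p (x≢y⇒x∉⁅y⁆ x≢y)

∣∁⁅x⁆∣≡n∸1 : ∀ {m} (x : Fin m) → ∣ ∁ ⁅ x ⁆ ∣ ≡ m ∸ 1
∣∁⁅x⁆∣≡n∸1 {m} x = trans (∣∁p∣≡n∸∣p∣ ⁅ x ⁆) (cong (m ∸_) (∣⁅x⁆∣≡1 x))

critical-≡ : (X : Graph) {k : ℕ} {c : Colouring X k} {S T : Subset (n X)} →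
  Critical X k c S → T ⊆ S → Determining X k c T → S ≡ T
critical-≡ X (_ , minimal) T⊆S detT = ⊆-antisym (minimal _ T⊆S detT) T⊆S

Unique : (ℕ → Set) → ℕ → Set
Unique P m = P m × (∀ j → P j → j ≡ m)

unique⇒isMinOf : ∀ {P m} → Unique P m → IsMinOf P m
unique⇒isMinOf (pm , only) = pm , λ j pj → ≤-reflexive (sym (only j pj))

unique⇒isMaxOf : ∀ {P m} → Unique P m → IsMaxOf P m
unique⇒isMaxOf (pm , only) = pm , λ j pj → ≤-reflexive (only j pj)

unique-isMinOf : ∀ {P m} → Unique P m → Unique (IsMinOf P) m
unique-isMinOf u = unique⇒isMinOf u , λ j min → proj₂ u j (proj₁ min)

unique-isMaxOf : ∀ {P m} → Unique P m → Unique (IsMaxOf P) m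
unique-isMaxOf u = unique⇒isMaxOf u , λ j max → proj₂ u j (proj₁ max)

unique-over : (X : Graph) {k m : ℕ} {Q : Colouring X k → ℕ → Set} →
  Σ (Colouring X k) (Proper X k) → (∀ c → Proper X k c → Unique (Q c) m) →
  Unique (Over X k Q) m
unique-over X (c , pc) u =
  (c , pc , proj₁ (u c pc)) , λ { j (c' , pc' , q) → proj₂ (u c' pc') j q }

paramValue-uniform : (X : Graph) {k m : ℕ} → IsChromatic X k →
  (∀ c → Proper X k c → Unique (CritSize X k c) m) → ∀ ρ → ParamValue ρ X m
paramValue-uniform X {k} χ u sn      =
  k , χ , unique⇒isMinOf (unique-over X (proj₁ χ) λ c pc → unique-isMinOf (u c pc))
paramValue-uniform X {k} χ u lcs-min =
  k , χ , unique⇒isMinOf (unique-over X (proj₁ χ) λ c pc → unique-isMaxOf (u c pc))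
paramValue-uniform X {k} χ u scs-max =
  k , χ , unique⇒isMaxOf (unique-over X (proj₁ χ) λ c pc → unique-isMinOf (u c pc))
paramValue-uniform X {k} χ u lcs-max =
  k , χ , unique⇒isMaxOf (unique-over X (proj₁ χ) λ c pc → unique-isMaxOf (u c pc))

-- Vertex zero is the centre of the star and one end of the edge, suc zero the other
-- end, and the suc (suc i) are the vertices left isolated in the subgraph.
module _ (m : ℕ) where

  star : Graph
  star = record { n = suc (suc m) ; adj = adj′ ; sym = sym′ ; irrefl = irrefl′ }
    where
    adj′ : Fin (suc (suc m)) → Fin (suc (suc m)) → Bool
    adj′ zero    zero    = false
    adj′ zero    (suc _) = true
    adj′ (suc _) zero    = true
    adj′ (suc _) (suc _) = false
    sym′ : ∀ u v → adj′ u v ≡ adj′ v u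
    sym′ zero    zero    = refl
    sym′ zero    (suc _) = refl
    sym′ (suc _) zero    = refl
    sym′ (suc _) (suc _) = refl
    irrefl′ : ∀ v → adj′ v v ≡ false
    irrefl′ zero    = refl
    irrefl′ (suc _) = refl

  centreColouring : Colouring star 2
  centreColouring zero    = zero
  centreColouring (suc _) = suc zero

  centreColouring-proper : Proper star 2 centreColouring
  centreColouring-proper zero    zero    ()
  centreColouring-proper zero    (suc _) _ ()
  centreColouring-proper (suc _) zero    _ ()
  centreColouring-proper (suc _) (suc _) ()

  star-agree : {c c' : Colouring star 2} → Proper star 2 c → Proper star 2 c' →
    ∀ v → c' v ≡ c v → ∀ w → c' w ≡ c w
  star-agree {c} {c'} pc pc' v eq = agree
    where
    atCentre : ∀ v → c' v ≡ c v → c' zero ≡ c zero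
    atCentre zero    eq = eq
    atCentre (suc _) eq = agree-across-edge star pc pc' refl eq
    agree : ∀ w → c' w ≡ c w
    agree zero    = atCentre v eq
    agree (suc _) = agree-across-edge star pc pc' refl (atCentre v eq)

  star-critSize : (c : Colouring star 2) → Proper star 2 c → Unique (CritSize star 2 c) 1
  star-critSize c pc = (⁅ zero ⁆ , (singleton zero , minimal) , ∣⁅x⁆∣≡1 {suc (suc m)} zero) , only
    where
    singleton : ∀ v → Determining star 2 c ⁅ v ⁆
    singleton v c' pc' agree = star-agree pc pc' v (agree v (x∈⁅x⁆ v))
    minimal : ∀ S → S ⊆ ⁅ zero ⁆ → Determining star 2 c S → ⁅ zero ⁆ ⊆ S
    minimal S S⊆ det with determining-nonempty star zero c pc det
    ... | w , w∈S = ⁅x⁆⊆ (subst (_∈ S) (x∈⁅y⁆⇒x≡y zero (S⊆ w∈S)) w∈S)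
    only : ∀ j → CritSize star 2 c j → j ≡ 1
    only j (S , crit , ∣S∣≡j) with determining-nonempty star zero c pc (proj₁ crit)
    ... | w , w∈S = begin
      j          ≡⟨ sym ∣S∣≡j ⟩
      ∣ S ∣      ≡⟨ cong ∣_∣ (critical-≡ star crit (⁅x⁆⊆ w∈S) (singleton w)) ⟩
      ∣ ⁅ w ⁆ ∣  ≡⟨ ∣⁅x⁆∣≡1 w ⟩
      1          ∎
      where open ≡-Reasoning

  edge+isolated : Graph
  edge+isolated = record { n = suc (suc m) ; adj = adj′ ; sym = sym′ ; irrefl = irrefl′ }
    where
    adj′ : Fin (suc (suc m)) → Fin (suc (suc m)) → Bool
    adj′ zero       (suc zero) = true
    adj′ (suc zero) zero       = true
    adj′ _          _          = false
    sym′ : ∀ u v → adj′ u v ≡ adj′ v u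
    sym′ zero             zero             = refl
    sym′ zero             (suc zero)       = refl
    sym′ zero             (suc (suc _))    = refl
    sym′ (suc zero)       zero             = refl
    sym′ (suc zero)       (suc zero)       = refl
    sym′ (suc zero)       (suc (suc _))    = refl
    sym′ (suc (suc _))    zero             = refl
    sym′ (suc (suc _))    (suc zero)       = refl
    sym′ (suc (suc _))    (suc (suc _))    = refl
    irrefl′ : ∀ v → adj′ v v ≡ false
    irrefl′ zero          = refl
    irrefl′ (suc zero)    = refl
    irrefl′ (suc (suc _)) = refl

  edge+isolated⇒star : ∀ u v → Edge edge+isolated u v → Edge star u v
  edge+isolated⇒star zero          (suc zero)    _  = refl
  edge+isolated⇒star (suc zero)    zero          _  = refl
  edge+isolated⇒star zero          zero          ()
  edge+isolated⇒star zero          (suc (suc _)) ()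
  edge+isolated⇒star (suc zero)    (suc _)       ()
  edge+isolated⇒star (suc (suc _)) _             ()

  endpoints : Subset (suc (suc m))
  endpoints = inside ∷ inside ∷ ⊥

  endpoints-closed : Closed edge+isolated endpoints
  endpoints-closed zero          (suc zero)    _  _ = there here
  endpoints-closed (suc zero)    zero          _  _ = here
  endpoints-closed zero          zero          ()
  endpoints-closed zero          (suc (suc _)) ()
  endpoints-closed (suc zero)    (suc _)       ()
  endpoints-closed (suc (suc _)) _             ()

  determining⇒endpoint×isolated : (c : Colouring edge+isolated 2) → Proper edge+isolated 2 c →
    ∀ {S} → Determining edge+isolated 2 c S →
    (zero ∈ S ⊎ suc zero ∈ S) × (∀ i → suc (suc i) ∈ S)
  determining⇒endpoint×isolated c pc det =
    endpoint (determining-meets-closed edge+isolated endpoints-closed (zero , here) c pc det) ,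
    λ i → isolated-∈-determining edge+isolated (λ _ ()) c pc det
    where
    endpoint : ∀ {S} → ∃ (λ v → v ∈ S × v ∈ endpoints) → zero ∈ S ⊎ suc zero ∈ S
    endpoint (zero          , v∈S , _) = inj₁ v∈S
    endpoint (suc zero      , v∈S , _) = inj₂ v∈S
    endpoint (suc (suc _)   , _   , there (there v∈⊥)) = ⊥-elim (∉⊥ v∈⊥)

  endpoint×isolated⇒determining : (c : Colouring edge+isolated 2) → Proper edge+isolated 2 c →
    ∀ {S} → zero ∈ S ⊎ suc zero ∈ S → (∀ i → suc (suc i) ∈ S) →
    Determining edge+isolated 2 c S
  endpoint×isolated⇒determining c pc {S} end iso c' pc' agree = agreeAll
    where
    agreeEnds : zero ∈ S ⊎ suc zero ∈ S → c' zero ≡ c zero × c' (suc zero) ≡ c (suc zero)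
    agreeEnds (inj₁ 0∈S) =
      agree zero 0∈S , agree-across-edge edge+isolated pc pc' refl (agree zero 0∈S)
    agreeEnds (inj₂ 1∈S) =
      agree-across-edge edge+isolated pc pc' refl (agree (suc zero) 1∈S) , agree (suc zero) 1∈S
    agreeAll : ∀ v → c' v ≡ c v
    agreeAll zero          = proj₁ (agreeEnds end)
    agreeAll (suc zero)    = proj₂ (agreeEnds end)
    agreeAll (suc (suc i)) = agree (suc (suc i)) (iso i)

  ∁⁅1⁆⊆ : ∀ {S : Subset (suc (suc m))} → zero ∈ S → (∀ i → suc (suc i) ∈ S) →
    ∁ ⁅ suc zero ⁆ ⊆ S
  ∁⁅1⁆⊆ 0∈S _   {zero}        _  = 0∈S
  ∁⁅1⁆⊆ _   _   {suc zero}    x∈ = ⊥-elim (x∈∁p⇒x∉p x∈ (x∈⁅x⁆ (suc zero)))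
  ∁⁅1⁆⊆ _   iso {suc (suc i)} _  = iso i

  ∁⁅0⁆⊆ : ∀ {S : Subset (suc (suc m))} → suc zero ∈ S → (∀ i → suc (suc i) ∈ S) →
    ∁ ⁅ zero ⁆ ⊆ S
  ∁⁅0⁆⊆ _   _   {zero}        x∈ = ⊥-elim (x∈∁p⇒x∉p x∈ (x∈⁅x⁆ zero))
  ∁⁅0⁆⊆ 1∈S _   {suc zero}    _  = 1∈S
  ∁⁅0⁆⊆ _   iso {suc (suc i)} _  = iso i

  module _ (c : Colouring edge+isolated 2) (pc : Proper edge+isolated 2 c) where

    ∁⁅1⁆-determining : Determining edge+isolated 2 c (∁ ⁅ suc zero ⁆)
    ∁⁅1⁆-determining = endpoint×isolated⇒determining c pc (inj₁ here)
      λ _ → x≢y⇒x∈∁⁅y⁆ {y = suc zero} λ ()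

    ∁⁅0⁆-determining : Determining edge+isolated 2 c (∁ ⁅ zero ⁆)
    ∁⁅0⁆-determining = endpoint×isolated⇒determining c pc (inj₂ (there here))
      λ _ → x≢y⇒x∈∁⁅y⁆ {y = zero} λ ()

    determining-⊇-∁⁅endpoint⁆ : ∀ {S} → Determining edge+isolated 2 c S →
      ∃ λ T → T ⊆ S × Determining edge+isolated 2 c T × ∣ T ∣ ≡ suc m
    determining-⊇-∁⁅endpoint⁆ det with determining⇒endpoint×isolated c pc det
    ... | inj₁ 0∈S , iso =
      ∁ ⁅ suc zero ⁆ , ∁⁅1⁆⊆ 0∈S iso , ∁⁅1⁆-determining , ∣∁⁅x⁆∣≡n∸1 (suc zero)
    ... | inj₂ 1∈S , iso =
      ∁ ⁅ zero ⁆ , ∁⁅0⁆⊆ 1∈S iso , ∁⁅0⁆-determining , ∣∁⁅x⁆∣≡n∸1 zero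

    edge+isolated-critSize : Unique (CritSize edge+isolated 2 c) (suc m)
    edge+isolated-critSize =
      (∁ ⁅ suc zero ⁆ , (∁⁅1⁆-determining , minimal) , ∣∁⁅x⁆∣≡n∸1 (suc zero)) , only
      where
      minimal : ∀ S → S ⊆ ∁ ⁅ suc zero ⁆ → Determining edge+isolated 2 c S → ∁ ⁅ suc zero ⁆ ⊆ S
      minimal S S⊆ det with determining⇒endpoint×isolated c pc det
      ... | inj₁ 0∈S , iso = ∁⁅1⁆⊆ 0∈S iso
      ... | inj₂ 1∈S , _   = ⊥-elim (x∈∁p⇒x∉p (S⊆ 1∈S) (x∈⁅x⁆ (suc zero)))
      only : ∀ j → CritSize edge+isolated 2 c j → j ≡ suc m
      only j (S , crit , ∣S∣≡j) with determining-⊇-∁⁅endpoint⁆ (proj₁ crit)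
      ... | T , T⊆S , detT , ∣T∣≡1+m = begin
        j      ≡⟨ sym ∣S∣≡j ⟩
        ∣ S ∣  ≡⟨ cong ∣_∣ (critical-≡ edge+isolated crit T⊆S detT) ⟩
        ∣ T ∣  ≡⟨ ∣T∣≡1+m ⟩
        suc m  ∎
        where open ≡-Reasoning

edge+isolated⊂star : ∀ m → ProperSubgraph (edge+isolated (suc m)) (star (suc m))
edge+isolated⊂star m =
  (λ v → v) , (λ _ _ eq → eq) , edge+isolated⇒star (suc m) ,
  inj₂ (zero , suc (suc zero) , refl , λ ())

mainTheorem14 : (ρ : Param) (N : ℕ) → N > 0 →
    Σ Graph λ G → Σ Graph λ H → ProperSubgraph H G ×
      Σ ℕ λ k → IsChromatic H k × IsChromatic G k ×
      Σ ℕ λ a → Σ ℕ λ b →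
        ParamValue ρ H a × ParamValue ρ G b × a > N * b
mainTheorem14 ρ (suc m) _ =
  star N , edge+isolated N , edge+isolated⊂star m ,
  2 , χH , χG ,
  suc N , 1 ,
  paramValue-uniform (edge+isolated N) χH (edge+isolated-critSize N) ρ ,
  paramValue-uniform (star N) χG (star-critSize N) ρ ,
  s≤s (≤-reflexive (*-identityʳ N))
  where
  N : ℕ
  N = suc m
  χG : IsChromatic (star N) 2
  χG = isChromatic-two (star N) {zero} {suc zero} refl
    (centreColouring N , centreColouring-proper N)
  χH : IsChromatic (edge+isolated N) 2
  χH = isChromatic-two (edge+isolated N) {zero} {suc zero} refl
    (centreColouring N , proper-∘ (edge+isolated N) (star N) (λ v → v) (edge+isolated⇒star N)
                           (centreColouring N) (centreColouring-proper N))
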